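{- Let $n \ge 0$ and $b \ge c > 0$ be integers, let $x$ be a real number, and define \[ S_n(b,c;x) = \sum_{k=0}^{n} (-1)^k \binom{n}{k} \frac{x^k}{\binom{b+k}{c}}. \] Then \[ S_n(b,c;x) = (b+1)\, B(b-c+1,c+1)\, {}_2F_1(-n,b-c+1;b+2;x) - n x \, B(b-c+2,c+1)\, {}_2F_1(1-n,b-c+2;b+3;x), \] where, when $n=0$, the second term (which carries the factor $n$) is understood to be $0$.
   Context: $B(p,q)=\int_0^1 t^{p-1}(1-t)^{q-1}\,\mathrm{d}t = \frac{\Gamma(p)\Gamma(q)}{\Gamma(p+q)}$ is the Euler Beta function. ${}_2F_1(a,b;c;z)=\sum_{j\ge 0}\frac{(a)_j(b)_j}{(c)_j\, j!}z^j$ is the Gauss hypergeometric function, with $(a)_j=a(a+1)\cdots(a+j-1)$ the Pochhammer symbol; when $a$ is a non-positive integer $-m$ the series terminates and is a polynomial in $z$ of degree at most $m$.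
   Formalization: The variable x ranges over the rationals instead of the real numbers. -}

module Defs where

open import Data.Nat using (ℕ; zero; suc; _∸_; _!) renaming (_+_ to _+ℕ_; _*_ to _*ℕ_)
open import Data.Integer using (+_)
open import Data.Nat.Combinatorics using (_C_)
open import Data.Rational using (ℚ; _/_; 0ℚ; 1ℚ; _+_; _*_; -_)

ℕtoℚ : ℕ → ℚ
ℕtoℚ n = (+ n) / 1

-- q / d for a natural denominator d (convention: value 0 when d = 0;
-- only ever used with positive d below)
_÷ℕ_ : ℚ → ℕ → ℚ
q ÷ℕ zero = 0ℚ
q ÷ℕ suc m = q * ((+ 1) / suc m)

_^ℚ_ : ℚ → ℕ → ℚ
x ^ℚ zero = 1ℚ
x ^ℚ suc k = (x ^ℚ k) * x

sumFrom0To : ℕ → (ℕ → ℚ) → ℚ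
sumFrom0To zero f = f 0
sumFrom0To (suc n) f = sumFrom0To n f + f (suc n)

poch : ℚ → ℕ → ℚ
poch a zero = 1ℚ
poch a (suc j) = poch a j * (a + ℕtoℚ j)

pochℕ : ℕ → ℕ → ℕ
pochℕ c zero = 1
pochℕ c (suc j) = pochℕ c j *ℕ (c +ℕ j)

-- Gauss hypergeometric series 2F1(a,b;c;z) for a positive integer c,
-- summed over j = 0..m.  When a = -m (a non-positive integer) this is the
-- full (terminating) series, since (a)_j = 0 for j > m.
2F1-upto : ℕ → ℚ → ℚ → ℕ → ℚ → ℚ
2F1-upto m a b c z =
  sumFrom0To m (λ j → ((poch a j * poch b j) ÷ℕ (pochℕ c j *ℕ (j !))) * (z ^ℚ j))

-- Euler Beta function at positive integer arguments p, q ≥ 1: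
-- B(p,q) = Γ(p)Γ(q)/Γ(p+q) = (p-1)!(q-1)!/(p+q-1)!
Beta : ℕ → ℕ → ℚ
Beta p q = ℕtoℚ ((p ∸ 1) ! *ℕ (q ∸ 1) !) ÷ℕ ((p +ℕ q ∸ 1) !)

S : ℕ → ℕ → ℕ → ℚ → ℚ
S n b c x = sumFrom0To n (λ k →
  (((- 1ℚ) ^ℚ k) * ℕtoℚ (n C k) * (x ^ℚ k)) ÷ℕ ((b +ℕ k) C c))


secondTerm : ℕ → ℕ → ℕ → ℚ → ℚ
secondTerm zero b c x = 0ℚ
secondTerm (suc m) b c x =
  ℕtoℚ (suc m) * x * Beta (b ∸ c +ℕ 2) (c +ℕ 1)
    * 2F1-upto m (- ℕtoℚ m) (ℕtoℚ (b ∸ c +ℕ 2)) (b +ℕ 3) x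

{-# OPTIONS --safe #-}
-- Write b = c + d and T k = (-1)^k C(n,k) x^k B(d+k+1, c+1).  Since (-n)_k / k! = (-1)^k C(n,k) and
-- B(d+1,c+1) (d+1)_k / (b+2)_k = B(d+k+1,c+1), the k-th term of B(d+1,c+1) 2F1(-n,d+1;b+2;x) is T k.
-- Since 1 / C(b+k,c) = (b+k+1) B(d+k+1,c+1), the k-th term of S is (b+1+k) T k, so
-- S = (b+1) Σ T k + Σ k T k.  The absorption identity (j+1) C(n,j+1) = n C(n-1,j) shows that
-- (j+1) T (j+1) is -n x times the j-th term of B(d+2,c+1) 2F1(1-n,d+2;b+3;x), i.e. Σ k T k is minus the second term.
module Submission where

open import Defs
open import Data.Nat using (ℕ; _≤_; _<_) renaming (_+_ to _+ℕ_)
open import Data.Nat using (_∸_)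
open import Data.Rational using (ℚ; _+_; _*_; _-_; -_)
open import Relation.Binary.PropositionalEquality using (_≡_)

open import Data.Nat using (zero; suc; _!; NonZero; z≤n; s≤s) renaming (_*_ to _*ℕ_)
import Data.Nat.Properties as ℕ
import Algebra.Properties.CommutativeSemigroup ℕ.*-commutativeSemigroup as ℕ*
import Algebra.Properties.CommutativeSemigroup ℕ.+-commutativeSemigroup as ℕ+
open import Data.Nat.Combinatorics using (_C_; nCk≡n!/k![n-k]!; k![n∸k]!∣n!)
open import Data.Nat.Combinatorics.Base using (_P′_)
open import Data.Nat.Combinatorics.Specification using (nP′k≡n!/[n∸k]!; nP′k≡n[n∸1P′k∸1])
open import Data.Nat.DivMod using (m/n*n≡m)
open import Data.Nat.Divisibility using (m≤n⇒m!∣n!)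
import Data.Nat.Tactic.RingSolver as ℕ-Solver
import Data.Integer as ℤ
import Data.Integer.Properties as ℤ
open import Data.Rational using (0ℚ; 1ℚ; toℚᵘ)
import Data.Rational.Properties as ℚ
open import Algebra.Bundles using (CommutativeMonoid)
import Algebra.Properties.CommutativeSemigroup (CommutativeMonoid.commutativeSemigroup ℚ.*-1-commutativeMonoid) as ℚ*
open import Data.Rational.Unnormalised as ℚᵘ using (mkℚᵘ; *≡*)
import Data.Rational.Unnormalised.Properties as ℚᵘ
open import Data.Product using (_,_)
open import Relation.Nullary.Decidable using (dec⇒maybe)
open import Level using (0ℓ)
open import Relation.Binary.PropositionalEquality using (refl; sym; trans; cong; cong₂; subst; module ≡-Reasoning)
open import Tactic.RingSolver using (solve-∀)
open import Tactic.RingSolver.Core.AlmostCommutativeRing using (AlmostCommutativeRing; fromCommutativeRing)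

-- The solver only cancels coefficients that this test recognises as 0.
ℚ-ring : AlmostCommutativeRing 0ℓ 0ℓ
ℚ-ring = fromCommutativeRing ℚ.+-*-commutativeRing (λ q → dec⇒maybe (0ℚ ℚ.≟ q))

toℚᵘ-ℕtoℚ : ∀ n → toℚᵘ (ℕtoℚ n) ℚᵘ.≃ mkℚᵘ (ℤ.+ n) 0
toℚᵘ-ℕtoℚ n = ℚ.toℚᵘ-fromℚᵘ (mkℚᵘ (ℤ.+ n) 0)

ℕtoℚ-+ : ∀ m n → ℕtoℚ (m +ℕ n) ≡ ℕtoℚ m + ℕtoℚ n
ℕtoℚ-+ m n = ℚ.toℚᵘ-injective (begin
    toℚᵘ (ℕtoℚ (m +ℕ n))                 ≈⟨ toℚᵘ-ℕtoℚ (m +ℕ n) ⟩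
    mkℚᵘ (ℤ.+ (m +ℕ n)) 0                ≈⟨ *≡* (cong (ℤ._* ℤ.+ 1) pos-+) ⟩
    mkℚᵘ (ℤ.+ m) 0 ℚᵘ.+ mkℚᵘ (ℤ.+ n) 0   ≈⟨ ℚᵘ.+-cong (toℚᵘ-ℕtoℚ m) (toℚᵘ-ℕtoℚ n) ⟨
    toℚᵘ (ℕtoℚ m) ℚᵘ.+ toℚᵘ (ℕtoℚ n)     ≈⟨ ℚ.toℚᵘ-homo-+ (ℕtoℚ m) (ℕtoℚ n) ⟨
    toℚᵘ (ℕtoℚ m + ℕtoℚ n)               ∎)
  where
  open ℚᵘ.≃-Reasoning
  pos-+ : ℤ.+ (m +ℕ n) ≡ ℤ.+ m ℤ.* ℤ.+ 1 ℤ.+ ℤ.+ n ℤ.* ℤ.+ 1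
  pos-+ = trans (ℤ.pos-+ m n) (sym (cong₂ ℤ._+_ (ℤ.*-identityʳ (ℤ.+ m)) (ℤ.*-identityʳ (ℤ.+ n))))

ℕtoℚ-* : ∀ m n → ℕtoℚ (m *ℕ n) ≡ ℕtoℚ m * ℕtoℚ n
ℕtoℚ-* m n = ℚ.toℚᵘ-injective (begin
    toℚᵘ (ℕtoℚ (m *ℕ n))                 ≈⟨ toℚᵘ-ℕtoℚ (m *ℕ n) ⟩
    mkℚᵘ (ℤ.+ (m *ℕ n)) 0                ≈⟨ *≡* (cong (ℤ._* ℤ.+ 1) (ℤ.pos-* m n)) ⟩
    mkℚᵘ (ℤ.+ m) 0 ℚᵘ.* mkℚᵘ (ℤ.+ n) 0   ≈⟨ ℚᵘ.*-cong (toℚᵘ-ℕtoℚ m) (toℚᵘ-ℕtoℚ n) ⟨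
    toℚᵘ (ℕtoℚ m) ℚᵘ.* toℚᵘ (ℕtoℚ n)     ≈⟨ ℚ.toℚᵘ-homo-* (ℕtoℚ m) (ℕtoℚ n) ⟨
    toℚᵘ (ℕtoℚ m * ℕtoℚ n)               ∎)
  where open ℚᵘ.≃-Reasoning

ℕtoℚ-inverseʳ : ∀ d .{{_ : NonZero d}} → ℕtoℚ d * (1ℚ ÷ℕ d) ≡ 1ℚ
ℕtoℚ-inverseʳ (suc m) = ℚ.toℚᵘ-injective (begin
    toℚᵘ (ℕtoℚ (suc m) * (1ℚ ÷ℕ suc m))            ≈⟨ ℚ.toℚᵘ-homo-* (ℕtoℚ (suc m)) (1ℚ ÷ℕ suc m) ⟩
    toℚᵘ (ℕtoℚ (suc m)) ℚᵘ.* toℚᵘ (1ℚ ÷ℕ suc m)    ≈⟨ ℚᵘ.*-cong (toℚᵘ-ℕtoℚ (suc m)) toℚᵘ-1÷ℕ ⟩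
    mkℚᵘ (ℤ.+ suc m) 0 ℚᵘ.* mkℚᵘ (ℤ.+ 1) m         ≈⟨ ℚᵘ.*-inverseʳ (mkℚᵘ (ℤ.+ suc m) 0) ⟩
    toℚᵘ 1ℚ                                        ∎)
  where
  open ℚᵘ.≃-Reasoning
  toℚᵘ-1÷ℕ : toℚᵘ (1ℚ ÷ℕ suc m) ℚᵘ.≃ mkℚᵘ (ℤ.+ 1) m
  toℚᵘ-1÷ℕ = ℚᵘ.≃-trans (ℚᵘ.≃-reflexive (cong toℚᵘ (ℚ.*-identityˡ _))) (ℚ.toℚᵘ-fromℚᵘ (mkℚᵘ (ℤ.+ 1) m))

÷ℕ≡*1÷ℕ : ∀ q d → q ÷ℕ d ≡ q * (1ℚ ÷ℕ d)
÷ℕ≡*1÷ℕ q zero    = sym (ℚ.*-zeroʳ q)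
÷ℕ≡*1÷ℕ q (suc d) = cong (q *_) (sym (ℚ.*-identityˡ _))

*-÷ℕ-assoc : ∀ p q d → p * (q ÷ℕ d) ≡ (p * q) ÷ℕ d
*-÷ℕ-assoc p q d = begin
  p * (q ÷ℕ d)          ≡⟨ cong (p *_) (÷ℕ≡*1÷ℕ q d) ⟩
  p * (q * (1ℚ ÷ℕ d))   ≡⟨ ℚ.*-assoc p q _ ⟨
  p * q * (1ℚ ÷ℕ d)     ≡⟨ ÷ℕ≡*1÷ℕ (p * q) d ⟨
  (p * q) ÷ℕ d          ∎
  where open ≡-Reasoning

*-÷ℕ-cancelʳ : ∀ p d .{{_ : NonZero d}} → (p * ℕtoℚ d) ÷ℕ d ≡ p
*-÷ℕ-cancelʳ p d = begin
  (p * ℕtoℚ d) ÷ℕ d            ≡⟨ ÷ℕ≡*1÷ℕ (p * ℕtoℚ d) d ⟩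
  p * ℕtoℚ d * (1ℚ ÷ℕ d)       ≡⟨ ℚ.*-assoc p (ℕtoℚ d) _ ⟩
  p * (ℕtoℚ d * (1ℚ ÷ℕ d))     ≡⟨ cong (p *_) (ℕtoℚ-inverseʳ d) ⟩
  p * 1ℚ                       ≡⟨ ℚ.*-identityʳ p ⟩
  p                            ∎
  where open ≡-Reasoning

1÷ℕ-* : ∀ d e .{{_ : NonZero d}} .{{_ : NonZero e}} → 1ℚ ÷ℕ (d *ℕ e) ≡ (1ℚ ÷ℕ d) * (1ℚ ÷ℕ e)
1÷ℕ-* d e = begin
  w                                      ≡⟨ ℚ.*-identityʳ w ⟨
  w * 1ℚ                                 ≡⟨ cong (w *_) D*u*[E*v]≡1 ⟨
  w * ((ℕtoℚ d * u) * (ℕtoℚ e * v))      ≡⟨ rearrange w (ℕtoℚ d) u (ℕtoℚ e) v ⟩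
  (ℕtoℚ d * ℕtoℚ e * w) * (u * v)        ≡⟨ cong (λ t → t * w * (u * v)) (ℕtoℚ-* d e) ⟨
  (ℕtoℚ (d *ℕ e) * w) * (u * v)          ≡⟨ cong (_* (u * v)) (ℕtoℚ-inverseʳ (d *ℕ e) {{ℕ.m*n≢0 d e}}) ⟩
  1ℚ * (u * v)                           ≡⟨ ℚ.*-identityˡ (u * v) ⟩
  u * v                                  ∎
  where
  open ≡-Reasoning
  u v w : ℚ
  u = 1ℚ ÷ℕ d
  v = 1ℚ ÷ℕ e
  w = 1ℚ ÷ℕ (d *ℕ e)
  D*u*[E*v]≡1 : (ℕtoℚ d * u) * (ℕtoℚ e * v) ≡ 1ℚ
  D*u*[E*v]≡1 = trans (cong₂ _*_ (ℕtoℚ-inverseʳ d) (ℕtoℚ-inverseʳ e)) (ℚ.*-identityˡ 1ℚ)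
  rearrange : ∀ w a u b v → w * ((a * u) * (b * v)) ≡ (a * b * w) * (u * v)
  rearrange = solve-∀ ℚ-ring

÷ℕ-*-÷ℕ : ∀ p q d e .{{_ : NonZero d}} .{{_ : NonZero e}} → (p ÷ℕ d) * (q ÷ℕ e) ≡ (p * q) ÷ℕ (d *ℕ e)
÷ℕ-*-÷ℕ p q d e = begin
  (p ÷ℕ d) * (q ÷ℕ e)                   ≡⟨ cong₂ _*_ (÷ℕ≡*1÷ℕ p d) (÷ℕ≡*1÷ℕ q e) ⟩
  (p * (1ℚ ÷ℕ d)) * (q * (1ℚ ÷ℕ e))     ≡⟨ interchange p _ q _ ⟩
  (p * q) * ((1ℚ ÷ℕ d) * (1ℚ ÷ℕ e))     ≡⟨ cong ((p * q) *_) (1÷ℕ-* d e) ⟨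
  (p * q) * (1ℚ ÷ℕ (d *ℕ e))            ≡⟨ ÷ℕ≡*1÷ℕ (p * q) (d *ℕ e) ⟨
  (p * q) ÷ℕ (d *ℕ e)                   ∎
  where
  open ≡-Reasoning
  interchange : ∀ a b c d → (a * b) * (c * d) ≡ (a * c) * (b * d)
  interchange = solve-∀ ℚ-ring

*-÷ℕ-*-cancelʳ : ∀ p d e .{{_ : NonZero d}} .{{_ : NonZero e}} → (p * ℕtoℚ e) ÷ℕ (d *ℕ e) ≡ p ÷ℕ d
*-÷ℕ-*-cancelʳ p d e = begin
  (p * ℕtoℚ e) ÷ℕ (d *ℕ e)     ≡⟨ ÷ℕ-*-÷ℕ p (ℕtoℚ e) d e ⟨
  (p ÷ℕ d) * (ℕtoℚ e ÷ℕ e)     ≡⟨ cong ((p ÷ℕ d) *_) (trans (÷ℕ≡*1÷ℕ (ℕtoℚ e) e) (ℕtoℚ-inverseʳ e)) ⟩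
  (p ÷ℕ d) * 1ℚ                ≡⟨ ℚ.*-identityʳ (p ÷ℕ d) ⟩
  p ÷ℕ d                       ∎
  where open ≡-Reasoning

ℕtoℚ-÷ℕ-cross : ∀ {m m′ d d′} .{{_ : NonZero d}} .{{_ : NonZero d′}} →
                m *ℕ d′ ≡ m′ *ℕ d → ℕtoℚ m ÷ℕ d ≡ ℕtoℚ m′ ÷ℕ d′
ℕtoℚ-÷ℕ-cross {m} {m′} {d} {d′} eq = begin
  ℕtoℚ m ÷ℕ d                          ≡⟨ *-÷ℕ-*-cancelʳ (ℕtoℚ m) d d′ ⟨
  (ℕtoℚ m * ℕtoℚ d′) ÷ℕ (d *ℕ d′)      ≡⟨ cong₂ _÷ℕ_ (sym (ℕtoℚ-* m d′)) (ℕ.*-comm d d′) ⟩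
  ℕtoℚ (m *ℕ d′) ÷ℕ (d′ *ℕ d)          ≡⟨ cong (λ n → ℕtoℚ n ÷ℕ (d′ *ℕ d)) eq ⟩
  ℕtoℚ (m′ *ℕ d) ÷ℕ (d′ *ℕ d)          ≡⟨ cong (_÷ℕ (d′ *ℕ d)) (ℕtoℚ-* m′ d) ⟩
  (ℕtoℚ m′ * ℕtoℚ d) ÷ℕ (d′ *ℕ d)      ≡⟨ *-÷ℕ-*-cancelʳ (ℕtoℚ m′) d′ d ⟩
  ℕtoℚ m′ ÷ℕ d′                        ∎
  where open ≡-Reasoning

n!*pochℕ[1+n]k≡[n+k]! : ∀ n k → n ! *ℕ pochℕ (suc n) k ≡ (n +ℕ k) !
n!*pochℕ[1+n]k≡[n+k]! n zero    = trans (ℕ.*-identityʳ (n !)) (cong _! (sym (ℕ.+-identityʳ n)))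
n!*pochℕ[1+n]k≡[n+k]! n (suc k) = begin
  n ! *ℕ (pochℕ (suc n) k *ℕ suc (n +ℕ k))    ≡⟨ ℕ.*-assoc (n !) _ _ ⟨
  n ! *ℕ pochℕ (suc n) k *ℕ suc (n +ℕ k)      ≡⟨ cong (_*ℕ suc (n +ℕ k)) (n!*pochℕ[1+n]k≡[n+k]! n k) ⟩
  (n +ℕ k) ! *ℕ suc (n +ℕ k)                  ≡⟨ ℕ.*-comm ((n +ℕ k) !) _ ⟩
  suc (n +ℕ k) !                              ≡⟨ cong _! (ℕ.+-suc n k) ⟨
  (n +ℕ suc k) !                              ∎
  where open ≡-Reasoning

nCk*k![n∸k]!≡n! : ∀ {n k} → k ≤ n → (n C k) *ℕ (k ! *ℕ (n ∸ k) !) ≡ n !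
nCk*k![n∸k]!≡n! {n} {k} k≤n = trans (cong (_*ℕ (k ! *ℕ (n ∸ k) !)) (nCk≡n!/k![n-k]! k≤n))
                                    (m/n*n≡m {{k ℕ.!* (n ∸ k) !≢0}} (k![n∸k]!∣n! k≤n))

nP′k*[n∸k]!≡n! : ∀ {n k} → k ≤ n → (n P′ k) *ℕ (n ∸ k) ! ≡ n !
nP′k*[n∸k]!≡n! {n} {k} k≤n = trans (cong (_*ℕ (n ∸ k) !) (nP′k≡n!/[n∸k]! k≤n))
                                   (m/n*n≡m {{(n ∸ k) ℕ.!≢0}} (m≤n⇒m!∣n! (ℕ.m∸n≤m n k)))

nCk*k!≡nP′k : ∀ {n k} → k ≤ n → (n C k) *ℕ k ! ≡ n P′ k
nCk*k!≡nP′k {n} {k} k≤n = ℕ.*-cancelʳ-≡ _ _ ((n ∸ k) !) {{(n ∸ k) ℕ.!≢0}} (begin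
  (n C k) *ℕ k ! *ℕ (n ∸ k) !     ≡⟨ ℕ.*-assoc (n C k) (k !) ((n ∸ k) !) ⟩
  (n C k) *ℕ (k ! *ℕ (n ∸ k) !)   ≡⟨ nCk*k![n∸k]!≡n! k≤n ⟩
  n !                             ≡⟨ nP′k*[n∸k]!≡n! k≤n ⟨
  (n P′ k) *ℕ (n ∸ k) !           ∎)
  where open ≡-Reasoning

[1+k]*[1+n]C[1+k]≡[1+n]*nCk : ∀ {n k} → k ≤ n → suc k *ℕ (suc n C suc k) ≡ suc n *ℕ (n C k)
[1+k]*[1+n]C[1+k]≡[1+n]*nCk {n} {k} k≤n = ℕ.*-cancelʳ-≡ _ _ (k !) {{k ℕ.!≢0}} (begin
  suc k *ℕ (suc n C suc k) *ℕ k !     ≡⟨ cong (_*ℕ k !) (ℕ.*-comm (suc k) (suc n C suc k)) ⟩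
  (suc n C suc k) *ℕ suc k *ℕ k !     ≡⟨ ℕ.*-assoc (suc n C suc k) (suc k) (k !) ⟩
  (suc n C suc k) *ℕ suc k !          ≡⟨ nCk*k!≡nP′k (s≤s k≤n) ⟩
  suc n P′ suc k                      ≡⟨ nP′k≡n[n∸1P′k∸1] (suc n) (suc k) ⟩
  suc n *ℕ (n P′ k)                   ≡⟨ cong (suc n *ℕ_) (nCk*k!≡nP′k k≤n) ⟨
  suc n *ℕ ((n C k) *ℕ k !)           ≡⟨ ℕ.*-assoc (suc n) (n C k) (k !) ⟨
  suc n *ℕ (n C k) *ℕ k !             ∎)
  where open ≡-Reasoning

pochℕ-nonZero : ∀ a k → NonZero (pochℕ (suc a) k)
pochℕ-nonZero a zero    = _
pochℕ-nonZero a (suc k) = ℕ.m*n≢0 (pochℕ (suc a) k) (suc (a +ℕ k)) {{pochℕ-nonZero a k}}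

poch-ℕtoℚ : ∀ a k → poch (ℕtoℚ a) k ≡ ℕtoℚ (pochℕ a k)
poch-ℕtoℚ a zero    = refl
poch-ℕtoℚ a (suc k) = trans (cong₂ _*_ (poch-ℕtoℚ a k) (sym (ℕtoℚ-+ a k))) (sym (ℕtoℚ-* (pochℕ a k) (a +ℕ k)))

poch-neg : ∀ {n k} → k ≤ n → poch (- ℕtoℚ n) k ≡ ((- 1ℚ) ^ℚ k) * ℕtoℚ (n P′ k)
poch-neg {n} {zero}  _   = refl
poch-neg {n} {suc k} k<n = begin
  poch (- ℕtoℚ n) k * (- ℕtoℚ n + ℕtoℚ k)
    ≡⟨ cong₂ (λ p m → p * (- m + ℕtoℚ k)) (poch-neg (ℕ.<⇒≤ k<n)) n≡[n∸k]+k ⟩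
  ((- 1ℚ) ^ℚ k * ℕtoℚ (n P′ k)) * (- (ℕtoℚ (n ∸ k) + ℕtoℚ k) + ℕtoℚ k)
    ≡⟨ rearrange ((- 1ℚ) ^ℚ k) (ℕtoℚ (n P′ k)) (ℕtoℚ (n ∸ k)) (ℕtoℚ k) ⟩
  ((- 1ℚ) ^ℚ k * - 1ℚ) * (ℕtoℚ (n ∸ k) * ℕtoℚ (n P′ k))
    ≡⟨ cong ((- 1ℚ) ^ℚ k * - 1ℚ *_) (ℕtoℚ-* (n ∸ k) (n P′ k)) ⟨
  ((- 1ℚ) ^ℚ k * - 1ℚ) * ℕtoℚ ((n ∸ k) *ℕ (n P′ k))
    ∎
  where
  open ≡-Reasoning
  n≡[n∸k]+k : ℕtoℚ n ≡ ℕtoℚ (n ∸ k) + ℕtoℚ k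
  n≡[n∸k]+k = trans (cong ℕtoℚ (sym (ℕ.m∸n+n≡m (ℕ.<⇒≤ k<n)))) (ℕtoℚ-+ (n ∸ k) k)
  rearrange : ∀ s p a j → (s * p) * (- (a + j) + j) ≡ (s * - 1ℚ) * (a * p)
  rearrange = solve-∀ ℚ-ring

poch-neg÷k! : ∀ {n k} → k ≤ n → poch (- ℕtoℚ n) k ÷ℕ (k !) ≡ ((- 1ℚ) ^ℚ k) * ℕtoℚ (n C k)
poch-neg÷k! {n} {k} k≤n = begin
  poch (- ℕtoℚ n) k ÷ℕ (k !)                    ≡⟨ cong (_÷ℕ (k !)) (poch-neg k≤n) ⟩
  (s * ℕtoℚ (n P′ k)) ÷ℕ (k !)                  ≡⟨ cong (λ m → (s * ℕtoℚ m) ÷ℕ (k !)) (nCk*k!≡nP′k k≤n) ⟨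
  (s * ℕtoℚ ((n C k) *ℕ k !)) ÷ℕ (k !)          ≡⟨ cong (λ q → (s * q) ÷ℕ (k !)) (ℕtoℚ-* (n C k) (k !)) ⟩
  (s * (ℕtoℚ (n C k) * ℕtoℚ (k !))) ÷ℕ (k !)    ≡⟨ cong (_÷ℕ (k !)) (ℚ.*-assoc s (ℕtoℚ (n C k)) (ℕtoℚ (k !))) ⟨
  (s * ℕtoℚ (n C k) * ℕtoℚ (k !)) ÷ℕ (k !)      ≡⟨ *-÷ℕ-cancelʳ (s * ℕtoℚ (n C k)) (k !) {{k ℕ.!≢0}} ⟩
  s * ℕtoℚ (n C k)                              ∎
  where
  open ≡-Reasoning
  s : ℚ
  s = (- 1ℚ) ^ℚ k

nCk-nonZero : ∀ {n k} → k ≤ n → NonZero (n C k)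
nCk-nonZero {n} {k} k≤n =
  ℕ.m*n≢0⇒m≢0 (n C k) {{subst NonZero (sym (nCk*k![n∸k]!≡n! k≤n)) (n ℕ.!≢0)}}

Beta-*-pochℕ÷pochℕ : ∀ c d k →
  Beta (suc d) (suc c) * (ℕtoℚ (pochℕ (suc d) k) ÷ℕ pochℕ (suc (d +ℕ suc c)) k) ≡ Beta (suc (d +ℕ k)) (suc c)
Beta-*-pochℕ÷pochℕ c d k = begin
  (ℕtoℚ (d ! *ℕ c !) ÷ℕ ((d +ℕ suc c) !)) * (ℕtoℚ (pochℕ (suc d) k) ÷ℕ pochℕ (suc (d +ℕ suc c)) k)
    ≡⟨ ÷ℕ-*-÷ℕ (ℕtoℚ (d ! *ℕ c !)) (ℕtoℚ (pochℕ (suc d) k)) ((d +ℕ suc c) !) (pochℕ (suc (d +ℕ suc c)) k)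
         {{(d +ℕ suc c) ℕ.!≢0}} {{pochℕ-nonZero (d +ℕ suc c) k}} ⟩
  (ℕtoℚ (d ! *ℕ c !) * ℕtoℚ (pochℕ (suc d) k)) ÷ℕ ((d +ℕ suc c) ! *ℕ pochℕ (suc (d +ℕ suc c)) k)
    ≡⟨ cong₂ _÷ℕ_ (trans (sym (ℕtoℚ-* (d ! *ℕ c !) (pochℕ (suc d) k))) (cong ℕtoℚ numerator)) denominator ⟩
  ℕtoℚ ((d +ℕ k) ! *ℕ c !) ÷ℕ ((d +ℕ k +ℕ suc c) !)
    ∎
  where
  open ≡-Reasoning
  numerator : d ! *ℕ c ! *ℕ pochℕ (suc d) k ≡ (d +ℕ k) ! *ℕ c !
  numerator = trans (ℕ*.xy∙z≈xz∙y (d !) (c !) _) (cong (_*ℕ c !) (n!*pochℕ[1+n]k≡[n+k]! d k))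
  denominator : (d +ℕ suc c) ! *ℕ pochℕ (suc (d +ℕ suc c)) k ≡ (d +ℕ k +ℕ suc c) !
  denominator = trans (n!*pochℕ[1+n]k≡[n+k]! (d +ℕ suc c) k) (cong _! (ℕ+.xy∙z≈xz∙y d (suc c) k))

1÷ℕ[c+d]Cc≡[1+c+d]*Beta : ∀ c d → 1ℚ ÷ℕ ((c +ℕ d) C c) ≡ ℕtoℚ (suc (c +ℕ d)) * Beta (suc d) (suc c)
1÷ℕ[c+d]Cc≡[1+c+d]*Beta c d = begin
  ℕtoℚ 1 ÷ℕ ((c +ℕ d) C c)
    ≡⟨ ℕtoℚ-÷ℕ-cross {1} {suc (c +ℕ d) *ℕ (d ! *ℕ c !)} {(c +ℕ d) C c} {(d +ℕ suc c) !}
         {{nCk-nonZero (ℕ.m≤m+n c d)}} {{(d +ℕ suc c) ℕ.!≢0}} cross ⟩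
  ℕtoℚ (suc (c +ℕ d) *ℕ (d ! *ℕ c !)) ÷ℕ ((d +ℕ suc c) !)
    ≡⟨ cong (_÷ℕ ((d +ℕ suc c) !)) (ℕtoℚ-* (suc (c +ℕ d)) (d ! *ℕ c !)) ⟩
  (ℕtoℚ (suc (c +ℕ d)) * ℕtoℚ (d ! *ℕ c !)) ÷ℕ ((d +ℕ suc c) !)
    ≡⟨ *-÷ℕ-assoc (ℕtoℚ (suc (c +ℕ d))) _ ((d +ℕ suc c) !) ⟨
  ℕtoℚ (suc (c +ℕ d)) * Beta (suc d) (suc c)
    ∎
  where
  open ≡-Reasoning
  cross : 1 *ℕ (d +ℕ suc c) ! ≡ suc (c +ℕ d) *ℕ (d ! *ℕ c !) *ℕ ((c +ℕ d) C c)
  cross = begin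
    1 *ℕ (d +ℕ suc c) !                                    ≡⟨ ℕ.*-identityˡ _ ⟩
    (d +ℕ suc c) !                                         ≡⟨ cong _! (trans (ℕ.+-suc d c) (cong suc (ℕ.+-comm d c))) ⟩
    suc (c +ℕ d) *ℕ (c +ℕ d) !                             ≡⟨ cong (suc (c +ℕ d) *ℕ_) (nCk*k![n∸k]!≡n! (ℕ.m≤m+n c d)) ⟨
    suc (c +ℕ d) *ℕ (((c +ℕ d) C c) *ℕ (c ! *ℕ (c +ℕ d ∸ c) !))
      ≡⟨ cong (λ e → suc (c +ℕ d) *ℕ (((c +ℕ d) C c) *ℕ (c ! *ℕ e !))) (ℕ.m+n∸m≡n c d) ⟩
    suc (c +ℕ d) *ℕ (((c +ℕ d) C c) *ℕ (c ! *ℕ d !))         ≡⟨ rearrange (suc (c +ℕ d)) ((c +ℕ d) C c) (c !) (d !) ⟩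
    suc (c +ℕ d) *ℕ (d ! *ℕ c !) *ℕ ((c +ℕ d) C c)         ∎
    where
    rearrange : ∀ a m x y → a *ℕ (m *ℕ (x *ℕ y)) ≡ a *ℕ (y *ℕ x) *ℕ m
    rearrange = ℕ-Solver.solve-∀

sumFrom0To-cong : ∀ n {f g : ℕ → ℚ} → (∀ {k} → k ≤ n → f k ≡ g k) → sumFrom0To n f ≡ sumFrom0To n g
sumFrom0To-cong zero    f≗g = f≗g z≤n
sumFrom0To-cong (suc n) f≗g = cong₂ _+_ (sumFrom0To-cong n (λ k≤n → f≗g (ℕ.m≤n⇒m≤1+n k≤n))) (f≗g ℕ.≤-refl)

*-distribˡ-sumFrom0To : ∀ n a (f : ℕ → ℚ) → a * sumFrom0To n f ≡ sumFrom0To n (λ k → a * f k)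
*-distribˡ-sumFrom0To zero    a f = refl
*-distribˡ-sumFrom0To (suc n) a f =
  trans (ℚ.*-distribˡ-+ a (sumFrom0To n f) (f (suc n))) (cong (_+ a * f (suc n)) (*-distribˡ-sumFrom0To n a f))

sumFrom0To-+ : ∀ n (f g : ℕ → ℚ) → sumFrom0To n (λ k → f k + g k) ≡ sumFrom0To n f + sumFrom0To n g
sumFrom0To-+ zero    f g = refl
sumFrom0To-+ (suc n) f g = trans (cong (_+ (f (suc n) + g (suc n))) (sumFrom0To-+ n f g))
                                 (interchange (sumFrom0To n f) (sumFrom0To n g) (f (suc n)) (g (suc n)))
  where
  interchange : ∀ a b c d → (a + b) + (c + d) ≡ (a + c) + (b + d)
  interchange = solve-∀ ℚ-ring

sumFrom0To-suc : ∀ n (f : ℕ → ℚ) → sumFrom0To (suc n) f ≡ f 0 + sumFrom0To n (λ k → f (suc k))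
sumFrom0To-suc zero    f = refl
sumFrom0To-suc (suc n) f = trans (cong (_+ f (suc (suc n))) (sumFrom0To-suc n f))
                                 (ℚ.+-assoc (f 0) (sumFrom0To n (λ k → f (suc k))) (f (suc (suc n))))

2F1-term : ℚ → ℚ → ℕ → ℚ → ℕ → ℚ
2F1-term a b c z j = ((poch a j * poch b j) ÷ℕ (pochℕ c j *ℕ (j !))) * (z ^ℚ j)

alternatingTerm : ℕ → ℚ → ℕ → ℚ
alternatingTerm n x k = ((- 1ℚ) ^ℚ k) * ℕtoℚ (n C k) * (x ^ℚ k)

betaTerm : ℕ → ℕ → ℕ → ℚ → ℕ → ℚ
betaTerm n c d x k = alternatingTerm n x k * Beta (suc (d +ℕ k)) (suc c)

Beta-*-2F1-term : ∀ {n k} c d x → k ≤ n →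
  Beta (suc d) (suc c) * 2F1-term (- ℕtoℚ n) (ℕtoℚ (suc d)) (suc (d +ℕ suc c)) x k ≡ betaTerm n c d x k
Beta-*-2F1-term {n} {k} c d x k≤n = begin
  B * (((a * poch (ℕtoℚ (suc d)) k) ÷ℕ (Q *ℕ (k !))) * (x ^ℚ k))   ≡⟨ cong (λ t → B * (t * (x ^ℚ k))) split ⟩
  B * (((a ÷ℕ (k !)) * (ℕtoℚ P ÷ℕ Q)) * (x ^ℚ k))                  ≡⟨ cong (λ t → B * ((t * (ℕtoℚ P ÷ℕ Q)) * (x ^ℚ k)))
                                                                         (poch-neg÷k! k≤n) ⟩
  B * ((((- 1ℚ) ^ℚ k * ℕtoℚ (n C k)) * (ℕtoℚ P ÷ℕ Q)) * (x ^ℚ k))  ≡⟨ rearrange B ((- 1ℚ) ^ℚ k) (ℕtoℚ (n C k)) (ℕtoℚ P ÷ℕ Q) (x ^ℚ k) ⟩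
  alternatingTerm n x k * (B * (ℕtoℚ P ÷ℕ Q))                     ≡⟨ cong (alternatingTerm n x k *_) (Beta-*-pochℕ÷pochℕ c d k) ⟩
  betaTerm n c d x k                                              ∎
  where
  open ≡-Reasoning
  a B : ℚ
  a = poch (- ℕtoℚ n) k
  B = Beta (suc d) (suc c)
  P Q : ℕ
  P = pochℕ (suc d) k
  Q = pochℕ (suc (d +ℕ suc c)) k
  split : (a * poch (ℕtoℚ (suc d)) k) ÷ℕ (Q *ℕ (k !)) ≡ (a ÷ℕ (k !)) * (ℕtoℚ P ÷ℕ Q)
  split = begin
    (a * poch (ℕtoℚ (suc d)) k) ÷ℕ (Q *ℕ (k !))   ≡⟨ cong₂ (λ p D → (a * p) ÷ℕ D) (poch-ℕtoℚ (suc d) k) (ℕ.*-comm Q (k !)) ⟩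
    (a * ℕtoℚ P) ÷ℕ ((k !) *ℕ Q)                  ≡⟨ ÷ℕ-*-÷ℕ a (ℕtoℚ P) (k !) Q {{k ℕ.!≢0}} {{pochℕ-nonZero (d +ℕ suc c) k}} ⟨
    (a ÷ℕ (k !)) * (ℕtoℚ P ÷ℕ Q)                  ∎
  rearrange : ∀ b s m r y → b * (((s * m) * r) * y) ≡ (s * m * y) * (b * r)
  rearrange = solve-∀ ℚ-ring

Beta-*-2F1≡ΣbetaTerm : ∀ n c d x →
  Beta (suc d) (suc c) * 2F1-upto n (- ℕtoℚ n) (ℕtoℚ (suc d)) (suc (d +ℕ suc c)) x ≡ sumFrom0To n (betaTerm n c d x)
Beta-*-2F1≡ΣbetaTerm n c d x =
  trans (*-distribˡ-sumFrom0To n (Beta (suc d) (suc c)) (2F1-term (- ℕtoℚ n) (ℕtoℚ (suc d)) (suc (d +ℕ suc c)) x))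
        (sumFrom0To-cong n (Beta-*-2F1-term c d x))

alternatingTerm÷C≡[1+b+k]*betaTerm : ∀ n c d x k →
  alternatingTerm n x k ÷ℕ ((c +ℕ d +ℕ k) C c) ≡ ℕtoℚ (suc (c +ℕ d +ℕ k)) * betaTerm n c d x k
alternatingTerm÷C≡[1+b+k]*betaTerm n c d x k rewrite ℕ.+-assoc c d k = begin
  A ÷ℕ ((c +ℕ (d +ℕ k)) C c)                ≡⟨ ÷ℕ≡*1÷ℕ A ((c +ℕ (d +ℕ k)) C c) ⟩
  A * (1ℚ ÷ℕ ((c +ℕ (d +ℕ k)) C c))         ≡⟨ cong (A *_) (1÷ℕ[c+d]Cc≡[1+c+d]*Beta c (d +ℕ k)) ⟩
  A * (ℕtoℚ (suc (c +ℕ (d +ℕ k))) * B)      ≡⟨ ℚ*.x∙yz≈y∙xz A (ℕtoℚ (suc (c +ℕ (d +ℕ k)))) B ⟩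
  ℕtoℚ (suc (c +ℕ (d +ℕ k))) * (A * B)      ∎
  where
  open ≡-Reasoning
  A B : ℚ
  A = alternatingTerm n x k
  B = Beta (suc (d +ℕ k)) (suc c)

S≡[1+b]*ΣbetaTerm+Σk*betaTerm : ∀ n c d x →
  S n (c +ℕ d) c x ≡ ℕtoℚ (suc (c +ℕ d)) * sumFrom0To n (betaTerm n c d x)
                     + sumFrom0To n (λ k → ℕtoℚ k * betaTerm n c d x k)
S≡[1+b]*ΣbetaTerm+Σk*betaTerm n c d x = begin
  S n (c +ℕ d) c x
    ≡⟨ sumFrom0To-cong n (λ {k} _ → trans (alternatingTerm÷C≡[1+b+k]*betaTerm n c d x k) (split k)) ⟩
  sumFrom0To n (λ k → ℕtoℚ (suc (c +ℕ d)) * T k + ℕtoℚ k * T k)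
    ≡⟨ sumFrom0To-+ n (λ k → ℕtoℚ (suc (c +ℕ d)) * T k) (λ k → ℕtoℚ k * T k) ⟩
  sumFrom0To n (λ k → ℕtoℚ (suc (c +ℕ d)) * T k) + sumFrom0To n (λ k → ℕtoℚ k * T k)
    ≡⟨ cong (_+ sumFrom0To n (λ k → ℕtoℚ k * T k)) (*-distribˡ-sumFrom0To n (ℕtoℚ (suc (c +ℕ d))) T) ⟨
  ℕtoℚ (suc (c +ℕ d)) * sumFrom0To n T + sumFrom0To n (λ k → ℕtoℚ k * T k)
    ∎
  where
  open ≡-Reasoning
  T : ℕ → ℚ
  T = betaTerm n c d x
  split : ∀ k → ℕtoℚ (suc (c +ℕ d +ℕ k)) * T k ≡ ℕtoℚ (suc (c +ℕ d)) * T k + ℕtoℚ k * T k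
  split k = trans (cong (_* T k) (ℕtoℚ-+ (suc (c +ℕ d)) k)) (ℚ.*-distribʳ-+ (T k) (ℕtoℚ (suc (c +ℕ d))) (ℕtoℚ k))

[1+j]*betaTerm[1+j] : ∀ {m j} c d x → j ≤ m →
  ℕtoℚ (suc j) * betaTerm (suc m) c d x (suc j) ≡ - (ℕtoℚ (suc m) * x) * betaTerm m c (suc d) x j
[1+j]*betaTerm[1+j] {m} {j} c d x j≤m = begin
  ℕtoℚ (suc j) * (alternatingTerm (suc m) x (suc j) * Beta (suc (d +ℕ suc j)) (suc c))
    ≡⟨ cong (λ e → ℕtoℚ (suc j) * (alternatingTerm (suc m) x (suc j) * Beta (suc e) (suc c))) (ℕ.+-suc d j) ⟩
  ℕtoℚ (suc j) * (((s * - 1ℚ) * ℕtoℚ (suc m C suc j)) * ((x ^ℚ j) * x) * B)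
    ≡⟨ rearrange₁ (ℕtoℚ (suc j)) s (ℕtoℚ (suc m C suc j)) (x ^ℚ j) x B ⟩
  - (x * (s * (x ^ℚ j) * B)) * (ℕtoℚ (suc j) * ℕtoℚ (suc m C suc j))
    ≡⟨ cong (- (x * (s * (x ^ℚ j) * B)) *_) absorption ⟩
  - (x * (s * (x ^ℚ j) * B)) * (ℕtoℚ (suc m) * ℕtoℚ (m C j))
    ≡⟨ rearrange₂ (ℕtoℚ (suc m)) s (ℕtoℚ (m C j)) (x ^ℚ j) x B ⟩
  - (ℕtoℚ (suc m) * x) * betaTerm m c (suc d) x j
    ∎
  where
  open ≡-Reasoning
  s B : ℚ
  s = (- 1ℚ) ^ℚ j
  B = Beta (suc (suc (d +ℕ j))) (suc c)
  absorption : ℕtoℚ (suc j) * ℕtoℚ (suc m C suc j) ≡ ℕtoℚ (suc m) * ℕtoℚ (m C j)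
  absorption = begin
    ℕtoℚ (suc j) * ℕtoℚ (suc m C suc j)   ≡⟨ ℕtoℚ-* (suc j) (suc m C suc j) ⟨
    ℕtoℚ (suc j *ℕ (suc m C suc j))       ≡⟨ cong ℕtoℚ ([1+k]*[1+n]C[1+k]≡[1+n]*nCk j≤m) ⟩
    ℕtoℚ (suc m *ℕ (m C j))               ≡⟨ ℕtoℚ-* (suc m) (m C j) ⟩
    ℕtoℚ (suc m) * ℕtoℚ (m C j)           ∎
  rearrange₁ : ∀ l s p y x b → l * (((s * - 1ℚ) * p) * (y * x) * b) ≡ - (x * (s * y * b)) * (l * p)
  rearrange₁ = solve-∀ ℚ-ring
  rearrange₂ : ∀ l s p y x b → - (x * (s * y * b)) * (l * p) ≡ - (l * x) * (s * p * y * b)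
  rearrange₂ = solve-∀ ℚ-ring

Σk*betaTerm≡-secondTerm : ∀ n c d x →
  sumFrom0To n (λ k → ℕtoℚ k * betaTerm n c d x k) ≡ - secondTerm n (c +ℕ d) c x
Σk*betaTerm≡-secondTerm zero    c d x = ℚ.*-zeroˡ (betaTerm 0 c d x 0)
Σk*betaTerm≡-secondTerm (suc m) c d x = begin
  sumFrom0To (suc m) (λ k → ℕtoℚ k * T k)
    ≡⟨ sumFrom0To-suc m (λ k → ℕtoℚ k * T k) ⟩
  ℕtoℚ 0 * T 0 + sumFrom0To m (λ j → ℕtoℚ (suc j) * T (suc j))
    ≡⟨ cong₂ _+_ (ℚ.*-zeroˡ (T 0)) (sumFrom0To-cong m ([1+j]*betaTerm[1+j] c d x)) ⟩
  0ℚ + sumFrom0To m (λ j → - (ℕtoℚ (suc m) * x) * T′ j)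
    ≡⟨ ℚ.+-identityˡ _ ⟩
  sumFrom0To m (λ j → - (ℕtoℚ (suc m) * x) * T′ j)
    ≡⟨ *-distribˡ-sumFrom0To m (- (ℕtoℚ (suc m) * x)) T′ ⟨
  - (ℕtoℚ (suc m) * x) * sumFrom0To m T′
    ≡⟨ ℚ.neg-distribˡ-* (ℕtoℚ (suc m) * x) (sumFrom0To m T′) ⟨
  - (ℕtoℚ (suc m) * x * sumFrom0To m T′)
    ≡⟨ cong -_ (trans secondTerm-unfolded (cong (ℕtoℚ (suc m) * x *_) (Beta-*-2F1≡ΣbetaTerm m c (suc d) x))) ⟨
  - secondTerm (suc m) (c +ℕ d) c x
    ∎
  where
  open ≡-Reasoning
  T T′ : ℕ → ℚ
  T  = betaTerm (suc m) c d x
  T′ = betaTerm m c (suc d) x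
  c+d+3≡[2+d]+[1+c] : ∀ c d → c +ℕ d +ℕ 3 ≡ suc (suc d +ℕ suc c)
  c+d+3≡[2+d]+[1+c] = ℕ-Solver.solve-∀
  secondTerm-unfolded : secondTerm (suc m) (c +ℕ d) c x
    ≡ ℕtoℚ (suc m) * x * (Beta (suc (suc d)) (suc c) * 2F1-upto m (- ℕtoℚ m) (ℕtoℚ (suc (suc d))) (suc (suc d +ℕ suc c)) x)
  secondTerm-unfolded rewrite ℕ.m+n∸m≡n c d | ℕ.+-comm d 2 | ℕ.+-comm c 1 | c+d+3≡[2+d]+[1+c] c d =
    ℚ.*-assoc (ℕtoℚ (suc m) * x) _ _

firstTerm≡[1+b]*ΣbetaTerm : ∀ n c d x →
  ℕtoℚ (c +ℕ d +ℕ 1) * Beta (c +ℕ d ∸ c +ℕ 1) (c +ℕ 1) * 2F1-upto n (- ℕtoℚ n) (ℕtoℚ (c +ℕ d ∸ c +ℕ 1)) (c +ℕ d +ℕ 2) x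
    ≡ ℕtoℚ (suc (c +ℕ d)) * sumFrom0To n (betaTerm n c d x)
firstTerm≡[1+b]*ΣbetaTerm n c d x =
  trans firstTerm-unfolded (cong (ℕtoℚ (suc (c +ℕ d)) *_) (Beta-*-2F1≡ΣbetaTerm n c d x))
  where
  c+d+2≡[1+d]+[1+c] : ∀ c d → c +ℕ d +ℕ 2 ≡ suc d +ℕ suc c
  c+d+2≡[1+d]+[1+c] = ℕ-Solver.solve-∀
  firstTerm-unfolded :
    ℕtoℚ (c +ℕ d +ℕ 1) * Beta (c +ℕ d ∸ c +ℕ 1) (c +ℕ 1) * 2F1-upto n (- ℕtoℚ n) (ℕtoℚ (c +ℕ d ∸ c +ℕ 1)) (c +ℕ d +ℕ 2) x
      ≡ ℕtoℚ (suc (c +ℕ d)) * (Beta (suc d) (suc c) * 2F1-upto n (- ℕtoℚ n) (ℕtoℚ (suc d)) (suc (d +ℕ suc c)) x)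
  firstTerm-unfolded
    rewrite ℕ.m+n∸m≡n c d | ℕ.+-comm (c +ℕ d) 1 | ℕ.+-comm d 1 | ℕ.+-comm c 1 | c+d+2≡[1+d]+[1+c] c d =
    ℚ.*-assoc (ℕtoℚ (suc (c +ℕ d))) _ _

proposition2 : (n b c : ℕ) → 0 < c → c ≤ b → (x : ℚ) →
    S n b c x ≡
      (ℕtoℚ (b +ℕ 1) * Beta (b ∸ c +ℕ 1) (c +ℕ 1)
        * 2F1-upto n (- ℕtoℚ n) (ℕtoℚ (b ∸ c +ℕ 1)) (b +ℕ 2) x)
      - secondTerm n b c x
proposition2 n b c _ c≤b x with ℕ.m≤n⇒∃[o]m+o≡n c≤b
... | d , refl = trans (S≡[1+b]*ΣbetaTerm+Σk*betaTerm n c d x)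
                       (cong₂ _+_ (sym (firstTerm≡[1+b]*ΣbetaTerm n c d x)) (Σk*betaTerm≡-secondTerm n c d x))
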